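{- Let $n\ge 3$, let $I$ be the $n\times n$ identity matrix, $T=\mathrm{circ}(0,1,0,\ldots,0)$ the $n\times n$ cyclic shift matrix, and $A=4I-T-T^{ -1}$. Then $\mathrm{Jac}(\Delta(n;1,1,1))$ is isomorphic to the torsion subgroup of the abelian group $\mathrm{coker}(I+A)\oplus\mathrm{coker}\big((-2I+A)(I+A)\big)$.
   Context: $\Delta(n;1,1,1)$ has vertices $v_{x,y}$, $x\in\{1,2,3\}$, $y\in\mathbb{Z}/n\mathbb{Z}$; $v_{x,y}$ is adjacent to $v_{x,y\pm1}$, and for each $y$ the vertices $v_{1,y},v_{2,y},v_{3,y}$ form a triangle. For an integer $r\times r$ matrix $N$, $\mathrm{coker}(N)=\mathbb{Z}^r/N\mathbb{Z}^r$. The Jacobian group of a connected graph $G$ is the torsion subgroup of $\mathrm{coker}(L(G))$, where $L(G)$ is its Laplacian (degree matrix minus adjacency matrix). $\mathrm{circ}(a_0,\ldots,a_{n-1})$ is the circulant matrix with first row $(a_0,\ldots,a_{n-1})$, each subsequent row being the previous one shifted cyclically to the right. -}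

module Defs where

open import Level using (Level; _⊔_; 0ℓ)
open import Data.Bool.Base using (Bool; true; false; if_then_else_; _∧_; _∨_; not)
open import Data.Nat.Base as ℕ using (ℕ; zero; suc; NonZero; _≡ᵇ_)
import Data.Nat.Properties as ℕP
open import Data.Nat.DivMod using (_mod_; _%_)
open import Data.Integer.Base as ℤ using (ℤ; _+_; _*_; -_; _-_)
open import Data.Integer.Properties as ℤP using (+-0-commutativeMonoid)
open import Data.Integer.Tactic.RingSolver using (solve-∀)
open import Data.Fin.Base using (Fin; toℕ; remQuot)
open import Data.Fin.Properties using (_≟_)
open import Data.Product.Base using (Σ; ∃; _×_; _,_; proj₁; proj₂)
open import Relation.Nullary.Decidable.Core using (⌊_⌋)
open import Relation.Binary.PropositionalEquality
open import Algebra.Bundles using (AbelianGroup; RawGroup)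
open import Algebra.Properties.CommutativeMonoid.Sum +-0-commutativeMonoid using (sum)

IVec : ℕ → Set
IVec r = Fin r → ℤ

Matrix : ℕ → Set
Matrix r = Fin r → Fin r → ℤ

_·ᵥ_ : ∀ {r} → Matrix r → IVec r → IVec r
(N ·ᵥ z) i = sum (λ j → N i j * z j)

_⊗_ : ∀ {r} → Matrix r → Matrix r → Matrix r
(M ⊗ N) i j = sum (λ k → M i k * N k j)

_⊕_ : ∀ {r} → Matrix r → Matrix r → Matrix r
(M ⊕ N) i j = M i j + N i j

_⊛_ : ∀ {r} → ℤ → Matrix r → Matrix r
(c ⊛ M) i j = c * M i j

⊝_ : ∀ {r} → Matrix r → Matrix r
(⊝ M) i j = - M i j

_≡ₘ_ : ∀ {r} → Matrix r → Matrix r → Set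
M ≡ₘ N = ∀ i j → M i j ≡ N i j

indicator : Bool → ℤ
indicator b = if b then ℤ.1ℤ else ℤ.0ℤ

Id : ∀ {r} → Matrix r
Id i j = indicator ⌊ i ≟ j ⌋

-- circ(a₀,…,a_{n-1}): entry (i,j) is a_{(j-i) mod n}
circ : ∀ {n} .{{_ : NonZero n}} → (Fin n → ℤ) → Matrix n
circ {n} a i j = a ((toℕ j ℕ.+ (n ℕ.∸ toℕ i)) mod n)

shiftT : ∀ {n} .{{_ : NonZero n}} → Matrix n
shiftT = circ (λ k → indicator (toℕ k ≡ᵇ 1))

-- Laplacian of a simple graph on vertex set Fin r given by a
-- (symmetric, irreflexive) Boolean adjacency relation.

degree : ∀ {r} → (Fin r → Fin r → Bool) → Fin r → ℤ
degree adj u = sum (λ v → indicator (adj u v))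

laplacian : ∀ {r} → (Fin r → Fin r → Bool) → Matrix r
laplacian adj u v = (if ⌊ u ≟ v ⌋ then degree adj u else ℤ.0ℤ) - indicator (adj u v)

cycAdj : ∀ {n} .{{_ : NonZero n}} → Fin n → Fin n → Bool
cycAdj {n} y y' = ((toℕ y ℕ.+ 1) % n ≡ᵇ toℕ y') ∨ ((toℕ y' ℕ.+ 1) % n ≡ᵇ toℕ y)

-- Δ(n;1,1,1) on vertices (x , y) ∈ Fin 3 × Fin n  (x = 0,1,2 stands for 1,2,3)
ΔAdj' : ∀ {n} .{{_ : NonZero n}} → Fin 3 × Fin n → Fin 3 × Fin n → Bool
ΔAdj' (x , y) (x' , y') =
  (⌊ x ≟ x' ⌋ ∧ cycAdj y y') ∨ (⌊ y ≟ y' ⌋ ∧ not ⌊ x ≟ x' ⌋)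

ΔAdj : ∀ n .{{_ : NonZero n}} → Fin (3 ℕ.* n) → Fin (3 ℕ.* n) → Bool
ΔAdj n u v = ΔAdj' (remQuot n u) (remQuot n v)

_≈[_]_ : ∀ {r} → IVec r → Matrix r → IVec r → Set
x ≈[ N ] y = ∃ λ z → ∀ i → x i - y i ≡ (N ·ᵥ z) i

private
  sum-0 : ∀ {r} (f : IVec r) → (∀ i → f i ≡ ℤ.0ℤ) → sum f ≡ ℤ.0ℤ
  sum-0 {zero} f h = refl
  sum-0 {suc r} f h = cong₂ _+_ (h Fin.zero) (sum-0 (λ i → f (Fin.suc i)) (λ i → h (Fin.suc i)))
    where import Data.Fin.Base as Fin

  sum-+ : ∀ {r} (f g : IVec r) → sum (λ i → f i + g i) ≡ sum f + sum g
  sum-+ {zero} f g = refl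
  sum-+ {suc r} f g =
    trans (cong (λ s → (f Fin.zero + g Fin.zero) + s) (sum-+ (λ i → f (Fin.suc i)) (λ i → g (Fin.suc i))))
          (lem (f Fin.zero) (g Fin.zero) _ _)
    where
    import Data.Fin.Base as Fin
    lem : ∀ a b c d → (a + b) + (c + d) ≡ (a + c) + (b + d)
    lem = solve-∀

  sum-neg : ∀ {r} (f : IVec r) → sum (λ i → - f i) ≡ - sum f
  sum-neg {zero} f = refl
  sum-neg {suc r} f =
    trans (cong (λ s → - f Fin.zero + s) (sum-neg (λ i → f (Fin.suc i))))
          (lem (f Fin.zero) _)
    where
    import Data.Fin.Base as Fin
    lem : ∀ a b → - a + - b ≡ - (a + b)
    lem = solve-∀

  mv-0 : ∀ {r} (N : Matrix r) i → (N ·ᵥ (λ _ → ℤ.0ℤ)) i ≡ ℤ.0ℤ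
  mv-0 N i = sum-0 (λ j → N i j * ℤ.0ℤ) (λ j → ℤP.*-zeroʳ (N i j))


module _ {r : ℕ} (N : Matrix r) where
  private
    sumc : ∀ {f g : IVec r} → (∀ i → f i ≡ g i) → sum f ≡ sum g
    sumc {f} {g} h = sumc' f g h
      where
      sumc' : ∀ {m} (f g : IVec m) → (∀ i → f i ≡ g i) → sum f ≡ sum g
      sumc' {zero} f g h = refl
      sumc' {suc m} f g h = cong₂ _+_ (h Fin.zero) (sumc' (λ i → f (Fin.suc i)) (λ i → g (Fin.suc i)) (λ i → h (Fin.suc i)))
        where import Data.Fin.Base as Fin

    lin+ : ∀ z w i → (N ·ᵥ (λ j → z j + w j)) i ≡ (N ·ᵥ z) i + (N ·ᵥ w) i
    lin+ z w i = trans (sumc (λ j → ℤP.*-distribˡ-+ (N i j) (z j) (w j))) (sum-+ (λ j → N i j * z j) (λ j → N i j * w j))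

    lin- : ∀ z i → (N ·ᵥ (λ j → - z j)) i ≡ - (N ·ᵥ z) i
    lin- z i = trans (sumc (λ j → sym (ℤP.neg-distribʳ-* (N i j) (z j)))) (sum-neg (λ j → N i j * z j))

    ≡⇒≈ : ∀ {x y : IVec r} → (∀ i → x i ≡ y i) → x ≈[ N ] y
    ≡⇒≈ {x} {y} h = (λ _ → ℤ.0ℤ) , λ i →
      trans (cong (λ t → t - y i) (h i)) (trans (ℤP.+-inverseʳ (y i)) (sym (mv-0 N i)))

  coker : AbelianGroup 0ℓ 0ℓ
  coker = record
    { Carrier = IVec r
    ; _≈_ = λ x y → x ≈[ N ] y
    ; _∙_ = λ x y i → x i + y i
    ; ε = λ _ → ℤ.0ℤ
    ; _⁻¹ = λ x i → - x i
    ; isAbelianGroup = record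
      { isGroup = record
        { isMonoid = record
          { isSemigroup = record
            { isMagma = record
              { isEquivalence = record
                { refl = λ {x} → ≡⇒≈ {x} {x} (λ _ → refl)
                ; sym = λ { {x} {y} (z , h) → (λ j → - z j) , λ i →
                    trans (l1 (x i) (y i)) (trans (cong -_ (h i)) (sym (lin- z i))) }
                ; trans = λ { {x} {y} {w} (z , h) (z' , h') → (λ j → z j + z' j) , λ i →
                    trans (l2 (x i) (y i) (w i)) (trans (cong₂ _+_ (h i) (h' i)) (sym (lin+ z z' i))) }
                }
              ; ∙-cong = λ { {x} {x'} {y} {y'} (z , h) (z' , h') → (λ j → z j + z' j) , λ i →
                    trans (l3 (x i) (x' i) (y i) (y' i)) (trans (cong₂ _+_ (h i) (h' i)) (sym (lin+ z z' i))) }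
              }
            ; assoc = λ x y w → ≡⇒≈ (λ i → ℤP.+-assoc (x i) (y i) (w i))
            }
          ; identity = (λ x → ≡⇒≈ (λ i → ℤP.+-identityˡ (x i))) , (λ x → ≡⇒≈ (λ i → ℤP.+-identityʳ (x i)))
          }
        ; inverse = (λ x → ≡⇒≈ (λ i → ℤP.+-inverseˡ (x i))) , (λ x → ≡⇒≈ (λ i → ℤP.+-inverseʳ (x i)))
        ; ⁻¹-cong = λ { {x} {y} (z , h) → (λ j → - z j) , λ i →
            trans (l4 (x i) (y i)) (trans (cong -_ (h i)) (sym (lin- z i))) }
        }
      ; comm = λ x y → ≡⇒≈ (λ i → ℤP.+-comm (x i) (y i))
      }
    }
    where
    l1 : ∀ a b → b - a ≡ - (a - b)
    l1 = solve-∀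
    l2 : ∀ a b c → a - c ≡ (a - b) + (b - c)
    l2 = solve-∀
    l3 : ∀ a a' b b' → (a + b) - (a' + b') ≡ (a - a') + (b - b')
    l3 = solve-∀
    l4 : ∀ a b → - a - - b ≡ - (a - b)
    l4 = solve-∀

module _ {a ℓ : Level} (G : AbelianGroup a ℓ) where
  open AbelianGroup G hiding (refl; sym; trans)
  open AbelianGroup G using () renaming (refl to ≈refl; sym to ≈sym; trans to ≈trans)
  open import Algebra.Properties.CommutativeMonoid.Mult commutativeMonoid
    renaming (_×_ to _·_) using (×-distrib-+; ×-assocˡ; ×-homo-1; ×-congʳ; ×-congˡ)
  open import Algebra.Properties.AbelianGroup G using (⁻¹-∙-comm)
  open import Algebra.Properties.Group group using (ε⁻¹≈ε)

  IsTorsion : Carrier → Set ℓ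
  IsTorsion x = ∃ λ (k : ℕ) → (1 ℕ.≤ k) × (k · x ≈ ε)

  private
    ×-ε : ∀ k → k · ε ≈ ε
    ×-ε zero = ≈refl
    ×-ε (suc k) = ≈trans (∙-congˡ (×-ε k)) (identityʳ ε)

    ×-⁻¹ : ∀ k x → k · (x ⁻¹) ≈ (k · x) ⁻¹
    ×-⁻¹ zero x = ≈sym ε⁻¹≈ε
    ×-⁻¹ (suc k) x = ≈trans (∙-congˡ (×-⁻¹ k x)) (⁻¹-∙-comm x (k · x))

    tors-∙ : ∀ {x y} → IsTorsion x → IsTorsion y → IsTorsion (x ∙ y)
    tors-∙ {x} {y} (k , k≥1 , kx) (m , m≥1 , my) =
      k ℕ.* m , ℕP.*-mono-≤ k≥1 m≥1 ,
      ≈trans (×-distrib-+ x y (k ℕ.* m))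
        (≈trans (∙-cong
                 (≈trans (×-congˡ {x} (ℕP.*-comm k m)) (≈trans (≈sym (×-assocˡ x m k)) (≈trans (×-congʳ m kx) (×-ε m))))
                 (≈trans (≈sym (×-assocˡ y k m)) (≈trans (×-congʳ k my) (×-ε k))))
               (identityʳ ε))

    tors-ε : IsTorsion ε
    tors-ε = 1 , ℕ.s≤s ℕ.z≤n , ×-homo-1 ε

    tors-⁻¹ : ∀ {x} → IsTorsion x → IsTorsion (x ⁻¹)
    tors-⁻¹ {x} (k , k≥1 , kx) = k , k≥1 , ≈trans (×-⁻¹ k x) (≈trans (⁻¹-cong kx) ε⁻¹≈ε)

  torsionSubgroup : AbelianGroup (a ⊔ ℓ) ℓ
  torsionSubgroup = record
    { Carrier = Σ Carrier IsTorsion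
    ; _≈_ = λ x y → proj₁ x ≈ proj₁ y
    ; _∙_ = λ x y → (proj₁ x ∙ proj₁ y) , tors-∙ (proj₂ x) (proj₂ y)
    ; ε = ε , tors-ε
    ; _⁻¹ = λ x → (proj₁ x ⁻¹) , tors-⁻¹ (proj₂ x)
    ; isAbelianGroup = record
      { isGroup = record
        { isMonoid = record
          { isSemigroup = record
            { isMagma = record
              { isEquivalence = record { refl = ≈refl ; sym = ≈sym ; trans = ≈trans }
              ; ∙-cong = ∙-cong
              }
            ; assoc = λ x y z → assoc (proj₁ x) (proj₁ y) (proj₁ z)
            }
          ; identity = (λ x → identityˡ (proj₁ x)) , (λ x → identityʳ (proj₁ x))
          }
        ; inverse = (λ x → inverseˡ (proj₁ x)) , (λ x → inverseʳ (proj₁ x))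
        ; ⁻¹-cong = ⁻¹-cong
        }
      ; comm = λ x y → comm (proj₁ x) (proj₁ y)
      }
    }

Jac : ∀ {r} → (Fin r → Fin r → Bool) → AbelianGroup 0ℓ 0ℓ
Jac adj = torsionSubgroup (coker (laplacian adj))

open import Algebra.Morphism.Structures using (module GroupMorphisms)

_≅_ : ∀ {a ℓ b ℓ'} → AbelianGroup a ℓ → AbelianGroup b ℓ' → Set (a ⊔ ℓ ⊔ b ⊔ ℓ')
G ≅ H = ∃ λ (f : AbelianGroup.Carrier G → AbelianGroup.Carrier H) →
  GroupMorphisms.IsGroupIsomorphism (AbelianGroup.rawGroup G) (AbelianGroup.rawGroup H) f

{-# OPTIONS --safe #-}
-- Ordering the vertices layer by layer, the Laplacian L of Δ(n;1,1,1) is the 3 × 3 block matrix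
-- with A = 4I − T − T⁻¹ on the diagonal and −I off it, i.e. (L z)ₓ = (I + A) zₓ − (z₀ + z₁ + z₂).
-- Integer row and column operations bring it to diag(I + A, (A − 2I)(I + A)); concretely
--   x ↦ (x₂ − x₁ , x₀ + x₁ + x₂ + (A − 2I) x₁)   and   (u , v) ↦ (v − u , 0 , u)
-- are mutually inverse isomorphisms between the cokernels, and isomorphic groups have
-- isomorphic torsion subgroups.
module Submission where

open import Defs
open import Data.Bool.Base using (Bool; true; false; if_then_else_; T; _∨_; _∧_; not)
open import Data.Bool.Properties using (∧-zeroʳ; ∧-identityʳ; ∨-identityʳ; if-float; if-cong-else)
open import Data.Nat.Base as ℕ using (ℕ; zero; suc; NonZero; _≤_; _<_; _∸_; _≡ᵇ_)
import Data.Nat.Properties as ℕ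
open import Data.Nat.DivMod using (_%_; _mod_; %-distribˡ-+; m%n%n≡m%n; [m+n]%n≡m%n; m<n⇒m%n≡m; n%n≡0; m%n<n)
open import Data.Integer.Base using (ℤ; +_; -_; _+_; _-_; _*_; 0ℤ; 1ℤ)
import Data.Integer.Properties as ℤ
open import Data.Integer.Tactic.RingSolver using (solve-∀)
open import Data.Fin.Base using (Fin; zero; suc; _↑ˡ_; _↑ʳ_; combine; remQuot; toℕ)
open import Data.Fin.Properties using (_≟_; remQuot-combine; combine-remQuot; toℕ-fromℕ<; toℕ-injective; toℕ<n)
open import Data.Fin.Patterns using (0F; 1F; 2F)
open import Algebra.Construct.DirectProduct using (abelianGroup)
open import Function.Base using (_∘_)
open import Relation.Nullary.Decidable using (Dec; does; ⌊_⌋; toWitness; ⌊⌋-map′; does-⇔; isYes≗does)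
open import Function.Bundles using (_⇔_; mk⇔; Equivalence)
open import Relation.Binary.PropositionalEquality
open import Relation.Nullary.Negation using (¬_; contradiction)
open import Algebra.Properties.Semiring.Sum ℤ.+-*-semiring
  using (sum-cong-≗; ∑-distrib-+; ∑-comm; sum-replicate-zero; *-distribˡ-sum; *-distribʳ-sum)
open import Algebra.Properties.CommutativeMonoid.Sum ℤ.+-0-commutativeMonoid using (sum)
open import Algebra.Bundles using (AbelianGroup)
open import Algebra.Morphism.Definitions using (Homomorphic₂)
open import Algebra.Morphism.Structures using (module GroupMorphisms)
import Algebra.Properties.CommutativeMonoid.Mult as Mult
import Algebra.Properties.Group as GroupProperties
open import Data.Product.Base using (_×_; _,_; ∃; proj₁; proj₂; uncurry)
open import Function.Definitions using (Congruent; Injective)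
open import Level using (Level)

private variable r : ℕ

sum-neg : ∀ (f : IVec r) → sum (λ j → - f j) ≡ - sum f
sum-neg f = begin
  sum (λ j → - f j)     ≡⟨ sum-cong-≗ (λ j → sym (ℤ.-1*i≡-i (f j))) ⟩
  sum (λ j → - 1ℤ * f j) ≡⟨ *-distribˡ-sum (- 1ℤ) f ⟨
  - 1ℤ * sum f          ≡⟨ ℤ.-1*i≡-i (sum f) ⟩
  - sum f               ∎
  where open ≡-Reasoning

sum-distrib-- : ∀ (f g : IVec r) → sum (λ j → f j - g j) ≡ sum f - sum g
sum-distrib-- f g = trans (∑-distrib-+ f (λ j → - g j)) (cong (_+_ (sum f)) (sum-neg g))

sum-select : ∀ (i : Fin r) (a b : IVec r) →
             sum (λ j → if ⌊ i ≟ j ⌋ then a j else b j) ≡ a i - b i + sum b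
sum-select {suc r} zero a b = ring (a zero) (b zero) (sum (b ∘ suc))
  where
  ring : ∀ a₀ b₀ s → a₀ + s ≡ a₀ - b₀ + (b₀ + s)
  ring = solve-∀
sum-select {suc r} (suc i) a b = begin
  b zero + sum (λ j → if ⌊ suc i ≟ suc j ⌋ then a (suc j) else b (suc j))
    ≡⟨ cong (_+_ (b zero)) (sum-cong-≗ (λ j → cong (if_then a (suc j) else b (suc j)) (⌊⌋-map′ _ _ (i ≟ j)))) ⟩
  b zero + sum (λ j → if ⌊ i ≟ j ⌋ then a (suc j) else b (suc j))
    ≡⟨ cong (_+_ (b zero)) (sum-select i (a ∘ suc) (b ∘ suc)) ⟩
  b zero + (a (suc i) - b (suc i) + sum (b ∘ suc))
    ≡⟨ ring (b zero) (a (suc i)) (b (suc i)) (sum (b ∘ suc)) ⟩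
  a (suc i) - b (suc i) + (b zero + sum (b ∘ suc)) ∎
  where
  open ≡-Reasoning
  ring : ∀ b₀ aᵢ bᵢ s → b₀ + (aᵢ - bᵢ + s) ≡ aᵢ - bᵢ + (b₀ + s)
  ring = solve-∀

sum-δ : ∀ (i : Fin r) (a : IVec r) → sum (λ j → if ⌊ i ≟ j ⌋ then a j else 0ℤ) ≡ a i
sum-δ {r} i a = begin
  sum (λ j → if ⌊ i ≟ j ⌋ then a j else 0ℤ) ≡⟨ sum-select i a (λ _ → 0ℤ) ⟩
  a i - 0ℤ + sum {r} (λ _ → 0ℤ)             ≡⟨ cong (_+_ (a i - 0ℤ)) (sum-replicate-zero r) ⟩
  a i - 0ℤ + 0ℤ                             ≡⟨ ring (a i) ⟩
  a i                                       ∎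
  where
  open ≡-Reasoning
  ring : ∀ x → x - 0ℤ + 0ℤ ≡ x
  ring = solve-∀

sum-↑ : ∀ m k (f : Fin (m ℕ.+ k) → ℤ) → sum f ≡ sum (f ∘ (_↑ˡ k)) + sum (f ∘ (m ↑ʳ_))
sum-↑ zero    k f = sym (ℤ.+-identityˡ (sum f))
sum-↑ (suc m) k f = trans (cong (_+_ (f zero)) (sum-↑ m k (f ∘ suc)))
                          (sym (ℤ.+-assoc (f zero) _ _))

sum-combine : ∀ m k (f : Fin (m ℕ.* k) → ℤ) → sum f ≡ sum (λ i → sum (λ j → f (combine {m} {k} i j)))
sum-combine zero    k f = refl
sum-combine (suc m) k f = trans (sum-↑ k (m ℕ.* k) f)
                                (cong (_+_ (sum (f ∘ (_↑ˡ m ℕ.* k)))) (sum-combine m k (f ∘ (k ↑ʳ_))))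

indicator-* : ∀ b x → indicator b * x ≡ (if b then x else 0ℤ)
indicator-* true  x = ℤ.*-identityˡ x
indicator-* false x = ℤ.*-zeroˡ x

module _ (M : Matrix r) where

  ·ᵥ-cong : ∀ {v w : IVec r} → v ≗ w → M ·ᵥ v ≗ M ·ᵥ w
  ·ᵥ-cong v≗w i = sum-cong-≗ (λ j → cong (M i j *_) (v≗w j))

  ·ᵥ-distrib-+ : ∀ (v w : IVec r) → M ·ᵥ (λ j → v j + w j) ≗ λ i → (M ·ᵥ v) i + (M ·ᵥ w) i
  ·ᵥ-distrib-+ v w i = trans (sum-cong-≗ (λ j → ℤ.*-distribˡ-+ (M i j) (v j) (w j)))
                             (∑-distrib-+ (λ j → M i j * v j) (λ j → M i j * w j))

  ·ᵥ-distrib-- : ∀ (v w : IVec r) → M ·ᵥ (λ j → v j - w j) ≗ λ i → (M ·ᵥ v) i - (M ·ᵥ w) i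
  ·ᵥ-distrib-- v w i = trans (sum-cong-≗ (λ j → ring (M i j) (v j) (w j)))
                             (sum-distrib-- (λ j → M i j * v j) (λ j → M i j * w j))
    where
    ring : ∀ m x y → m * (x - y) ≡ m * x - m * y
    ring = solve-∀

  ·ᵥ-*ˡ : ∀ c (v : IVec r) → M ·ᵥ (λ j → c * v j) ≗ λ i → c * (M ·ᵥ v) i
  ·ᵥ-*ˡ c v i = trans (sum-cong-≗ (λ j → ring (M i j) c (v j))) (sym (*-distribˡ-sum c (λ j → M i j * v j)))
    where
    ring : ∀ m c x → m * (c * x) ≡ c * (m * x)
    ring = solve-∀

  ·ᵥ-zeroʳ : M ·ᵥ (λ _ → 0ℤ) ≗ λ _ → 0ℤ
  ·ᵥ-zeroʳ i = trans (sum-cong-≗ (λ j → ℤ.*-zeroʳ (M i j))) (sum-replicate-zero r)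

Id-·ᵥ : ∀ (v : IVec r) → Id ·ᵥ v ≗ v
Id-·ᵥ v i = trans (sum-cong-≗ (λ j → indicator-* ⌊ i ≟ j ⌋ (v j))) (sum-δ i v)

⊕-·ᵥ : ∀ (M N : Matrix r) v → (M ⊕ N) ·ᵥ v ≗ λ i → (M ·ᵥ v) i + (N ·ᵥ v) i
⊕-·ᵥ M N v i = trans (sum-cong-≗ (λ j → ℤ.*-distribʳ-+ (v j) (M i j) (N i j)))
                     (∑-distrib-+ (λ j → M i j * v j) (λ j → N i j * v j))

⊛-·ᵥ : ∀ c (M : Matrix r) v → (c ⊛ M) ·ᵥ v ≗ λ i → c * (M ·ᵥ v) i
⊛-·ᵥ c M v i = trans (sum-cong-≗ (λ j → ℤ.*-assoc c (M i j) (v j))) (sym (*-distribˡ-sum c (λ j → M i j * v j)))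

⊝-·ᵥ : ∀ (M : Matrix r) v → (⊝ M) ·ᵥ v ≗ λ i → - (M ·ᵥ v) i
⊝-·ᵥ M v i = trans (sum-cong-≗ (λ j → sym (ℤ.neg-distribˡ-* (M i j) (v j)))) (sum-neg (λ j → M i j * v j))

⊗-·ᵥ : ∀ (M N : Matrix r) v → (M ⊗ N) ·ᵥ v ≗ M ·ᵥ (N ·ᵥ v)
⊗-·ᵥ M N v i = begin
  sum (λ j → sum (λ k → M i k * N k j) * v j)    ≡⟨ sum-cong-≗ (λ j → *-distribʳ-sum (v j) (λ k → M i k * N k j)) ⟩
  sum (λ j → sum (λ k → M i k * N k j * v j))    ≡⟨ ∑-comm (λ j k → M i k * N k j * v j) ⟩
  sum (λ k → sum (λ j → M i k * N k j * v j))
    ≡⟨ sum-cong-≗ (λ k → trans (sum-cong-≗ (λ j → ℤ.*-assoc (M i k) (N k j) (v j)))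
                               (sym (*-distribˡ-sum (M i k) (λ j → N k j * v j)))) ⟩
  sum (λ k → M i k * sum (λ j → N k j * v j))    ∎
  where open ≡-Reasoning

Id⊕-·ᵥ : ∀ (A : Matrix r) v → (Id ⊕ A) ·ᵥ v ≗ λ y → v y + (A ·ᵥ v) y
Id⊕-·ᵥ A v y = trans (⊕-·ᵥ Id A v y) (cong (_+ (A ·ᵥ v) y) (Id-·ᵥ v y))

[-2I+A]⊗[I+A]-·ᵥ : ∀ (A : Matrix r) w →
  ((((- + 2) ⊛ Id) ⊕ A) ⊗ (Id ⊕ A)) ·ᵥ w ≗ λ y → ((Id ⊕ A) ·ᵥ ((Id ⊕ A) ·ᵥ w)) y - + 3 * ((Id ⊕ A) ·ᵥ w) y
[-2I+A]⊗[I+A]-·ᵥ A w y = begin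
  (((((- + 2) ⊛ Id) ⊕ A) ⊗ B) ·ᵥ w) y        ≡⟨ ⊗-·ᵥ (((- + 2) ⊛ Id) ⊕ A) B w y ⟩
  ((((- + 2) ⊛ Id) ⊕ A) ·ᵥ Bw) y             ≡⟨ ⊕-·ᵥ ((- + 2) ⊛ Id) A Bw y ⟩
  (((- + 2) ⊛ Id) ·ᵥ Bw) y + (A ·ᵥ Bw) y
    ≡⟨ cong (_+ (A ·ᵥ Bw) y) (trans (⊛-·ᵥ (- + 2) Id Bw y) (cong (- + 2 *_) (Id-·ᵥ Bw y))) ⟩
  - + 2 * Bw y + (A ·ᵥ Bw) y                 ≡⟨ ring (Bw y) ((A ·ᵥ Bw) y) ⟩
  (Bw y + (A ·ᵥ Bw) y) - + 3 * Bw y          ≡⟨ cong (_- + 3 * Bw y) (Id⊕-·ᵥ A Bw y) ⟨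
  (B ·ᵥ Bw) y - + 3 * Bw y                   ∎
  where
  open ≡-Reasoning
  B = Id ⊕ A
  Bw = B ·ᵥ w
  ring : ∀ b ab → - + 2 * b + ab ≡ (b + ab) - + 3 * b
  ring = solve-∀

-- Group isomorphisms and torsion subgroups

module _ {a ℓ b ℓ′ : Level} {G : AbelianGroup a ℓ} {H : AbelianGroup b ℓ′} where
  private
    module G = AbelianGroup G
    module H = AbelianGroup H
    module G× = Mult G.commutativeMonoid
    module H× = Mult H.commutativeMonoid
  open GroupMorphisms G.rawGroup H.rawGroup
  open GroupProperties H.group using (identityʳ-unique; inverseˡ-unique)

  ∙-homo⇒isGroupHomomorphism : ∀ {f} → Congruent G._≈_ H._≈_ f →
    Homomorphic₂ G.Carrier H.Carrier H._≈_ f G._∙_ H._∙_ → IsGroupHomomorphism f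
  ∙-homo⇒isGroupHomomorphism {f} f-cong ∙-homo = record
    { isMonoidHomomorphism = record
      { isMagmaHomomorphism = record
        { isRelHomomorphism = record { cong = f-cong }
        ; homo = ∙-homo
        }
      ; ε-homo = ε-homo
      }
    ; ⁻¹-homo = λ x → inverseˡ-unique (f (x G.⁻¹)) (f x)
        (H.trans (H.sym (∙-homo (x G.⁻¹) x)) (H.trans (f-cong (G.inverseˡ x)) ε-homo))
    }
    where
    ε-homo : f G.ε H.≈ H.ε
    ε-homo = identityʳ-unique (f G.ε) (f G.ε)
      (H.trans (H.sym (∙-homo G.ε G.ε)) (f-cong (G.identityˡ G.ε)))

  inverse⇒≅ : (f : G.Carrier → H.Carrier) (g : H.Carrier → G.Carrier) →
    Congruent G._≈_ H._≈_ f → Congruent H._≈_ G._≈_ g →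
    Homomorphic₂ G.Carrier H.Carrier H._≈_ f G._∙_ H._∙_ →
    (∀ y → f (g y) H.≈ y) → (∀ x → g (f x) G.≈ x) → G ≅ H
  inverse⇒≅ f g f-cong g-cong ∙-homo fg≈id gf≈id = f , record
    { isGroupMonomorphism = record
      { isGroupHomomorphism = ∙-homo⇒isGroupHomomorphism f-cong ∙-homo
      ; injective = λ {x} {y} fx≈fy →
          G.trans (G.sym (gf≈id x)) (G.trans (g-cong fx≈fy) (gf≈id y))
      }
    ; surjective = λ y → g y , λ z≈gy → H.trans (f-cong z≈gy) (fg≈id y)
    }

  module _ {f : G.Carrier → H.Carrier} (f-homo : IsGroupHomomorphism f) where
    open IsGroupHomomorphism f-homo

    ×-homo : ∀ k x → f (k G×.× x) H.≈ k H×.× f x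
    ×-homo zero    x = ε-homo
    ×-homo (suc k) x = H.trans (homo x (k G×.× x)) (H.∙-congˡ (×-homo k x))

    isTorsion-homo : ∀ {x} → IsTorsion G x → IsTorsion H (f x)
    isTorsion-homo {x} (k , 1≤k , kx≈ε) = k , 1≤k , H.trans (H.sym (×-homo k x)) (H.trans (⟦⟧-cong kx≈ε) ε-homo)

    isTorsion-reflect : Injective G._≈_ H._≈_ f → ∀ {x y} → f x H.≈ y → IsTorsion H y → IsTorsion G x
    isTorsion-reflect inj {x} fx≈y (k , 1≤k , ky≈ε) = k , 1≤k , inj
      (H.trans (×-homo k x) (H.trans (H×.×-congʳ k fx≈y) (H.trans ky≈ε (H.sym ε-homo))))

torsionSubgroup-≅ : ∀ {a ℓ b ℓ′} {G : AbelianGroup a ℓ} {H : AbelianGroup b ℓ′} →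
  G ≅ H → torsionSubgroup G ≅ torsionSubgroup H
torsionSubgroup-≅ {G = G} {H} (f , iso) = F , record
  { isGroupMonomorphism = record
    { isGroupHomomorphism = ∙-homo⇒isGroupHomomorphism {G = torsionSubgroup G} {torsionSubgroup H}
        ⟦⟧-cong (λ x y → ∙-homo (proj₁ x) (proj₁ y))
    ; injective = injective
    }
  ; surjective = λ (y , y-torsion) →
      let (x , fx≈y) = surjective y
      in (x , isTorsion-reflect {G = G} {H} isGroupHomomorphism injective (fx≈y (AbelianGroup.refl G)) y-torsion)
         , fx≈y
  }
  where
  open GroupMorphisms.IsGroupIsomorphism iso
  F : AbelianGroup.Carrier (torsionSubgroup G) → AbelianGroup.Carrier (torsionSubgroup H)
  F (x , x-torsion) = f x , isTorsion-homo {G = G} {H} isGroupHomomorphism x-torsion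

-- Cokernels of 3 × 3 block matrices

≗⇒≈ : ∀ (N : Matrix r) {v w : IVec r} → v ≗ w → v ≈[ N ] w
≗⇒≈ N {v} {w} v≗w = (λ _ → 0ℤ) , λ i →
  trans (cong (_- w i) (v≗w i)) (trans (ℤ.+-inverseʳ (w i)) (sym (·ᵥ-zeroʳ N i)))

module Blocks (n : ℕ) where

  block : IVec (3 ℕ.* n) → Fin 3 → IVec n
  block z x y = z (combine x y)

  blockSum : IVec (3 ℕ.* n) → IVec n
  blockSum z y = block z 0F y + block z 1F y + block z 2F y

  blocks : IVec n → IVec n → IVec n → Fin 3 → IVec n
  blocks z₀ z₁ z₂ 0F = z₀
  blocks z₀ z₁ z₂ 1F = z₁
  blocks z₀ z₁ z₂ 2F = z₂

  fromBlocks : (Fin 3 → IVec n) → IVec (3 ℕ.* n)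
  fromBlocks b q = uncurry b (remQuot n q)

  block-fromBlocks : ∀ b x → block (fromBlocks b) x ≗ b x
  block-fromBlocks b x y = cong (uncurry b) (remQuot-combine x y)

  blockSum-fromBlocks : ∀ b y → blockSum (fromBlocks b) y ≡ b 0F y + b 1F y + b 2F y
  blockSum-fromBlocks b y =
    cong₂ _+_ (cong₂ _+_ (block-fromBlocks b 0F y) (block-fromBlocks b 1F y)) (block-fromBlocks b 2F y)

  ∀-combine : ∀ {P : Fin (3 ℕ.* n) → Set} → (∀ x y → P (combine x y)) → ∀ q → P q
  ∀-combine {P} P-combine q = subst P (combine-remQuot {3} n q) (uncurry P-combine (remQuot {3} n q))

-- Read as a 3 × 3 block matrix, L has B - I on the diagonal and - I off it.
module BlockCokernel {n : ℕ} (B C : Matrix n) (L : Matrix (3 ℕ.* n))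
  (C-·ᵥ : ∀ w y → (C ·ᵥ w) y ≡ (B ·ᵥ (B ·ᵥ w)) y - + 3 * (B ·ᵥ w) y)
  (L-·ᵥ : ∀ z x y → (L ·ᵥ z) (combine x y) ≡ (B ·ᵥ Blocks.block n z x) y - Blocks.blockSum n z y)
  where

  open Blocks n

  private
    Pair : Set
    Pair = IVec n × IVec n

    _≈ᴾ_ : Pair → Pair → Set
    (u , v) ≈ᴾ (u′ , v′) = u ≈[ B ] u′ × v ≈[ C ] v′

  toPair : IVec (3 ℕ.* n) → Pair
  toPair x = (λ y → x₂ y - x₁ y) , (λ y → blockSum x y + (B ·ᵥ x₁) y - + 3 * x₁ y)
    where x₁ = block x 1F; x₂ = block x 2F

  fromPair : Pair → IVec (3 ℕ.* n)
  fromPair (u , v) = fromBlocks (blocks (λ y → v y - u y) (λ _ → 0ℤ) u)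

  block-fromPair : ∀ p x → block (fromPair p) x ≗ blocks (λ y → proj₂ p y - proj₁ p y) (λ _ → 0ℤ) (proj₁ p) x
  block-fromPair (u , v) = block-fromBlocks (blocks (λ y → v y - u y) (λ _ → 0ℤ) u)

  ≈ᴸ-intro : ∀ {a a′ : IVec (3 ℕ.* n)} (z₀ z₁ z₂ : IVec n) →
    (∀ x y → block a x y - block a′ x y ≡ (B ·ᵥ blocks z₀ z₁ z₂ x) y - (z₀ y + z₁ y + z₂ y)) →
    a ≈[ L ] a′
  ≈ᴸ-intro {a} {a′} z₀ z₁ z₂ eq = z , ∀-combine λ x y → begin
    a (combine x y) - a′ (combine x y)               ≡⟨ eq x y ⟩
    (B ·ᵥ blocks z₀ z₁ z₂ x) y - (z₀ y + z₁ y + z₂ y)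
      ≡⟨ cong₂ _-_ (·ᵥ-cong B (block-fromBlocks (blocks z₀ z₁ z₂) x) y) (blockSum-fromBlocks (blocks z₀ z₁ z₂) y) ⟨
    (B ·ᵥ block z x) y - blockSum z y                ≡⟨ L-·ᵥ z x y ⟨
    (L ·ᵥ z) (combine x y)                           ∎
    where
    open ≡-Reasoning
    z = fromBlocks (blocks z₀ z₁ z₂)

  ≈ᴸ-elim : ∀ {a a′ : IVec (3 ℕ.* n)} → a ≈[ L ] a′ → ∃ λ z →
    ∀ x y → block a x y - block a′ x y ≡ (B ·ᵥ block z x) y - blockSum z y
  ≈ᴸ-elim (z , eq) = z , λ x y → trans (eq (combine x y)) (L-·ᵥ z x y)

  ·ᵥ-blockSum : ∀ z y → (B ·ᵥ blockSum z) y ≡ (B ·ᵥ block z 0F) y + (B ·ᵥ block z 1F) y + (B ·ᵥ block z 2F) y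
  ·ᵥ-blockSum z y = trans (·ᵥ-distrib-+ B _ (block z 2F) y)
                          (cong (_+ (B ·ᵥ block z 2F) y) (·ᵥ-distrib-+ B (block z 0F) (block z 1F) y))

  toPair-cong : ∀ {x x′} → x ≈[ L ] x′ → toPair x ≈ᴾ toPair x′
  toPair-cong {x} {x′} x≈x′ with z , Δ≡ ← ≈ᴸ-elim {x} {x′} x≈x′ =
    ((λ j → zᵢ 2F j - zᵢ 1F j) , first) , (zᵢ 1F , second)
    where
    open ≡-Reasoning
    zᵢ = block z
    Bz : Fin 3 → IVec n
    Bz i = B ·ᵥ zᵢ i
    s = blockSum z
    xᵢ = block x
    x′ᵢ = block x′
    first : ∀ y → (xᵢ 2F y - xᵢ 1F y) - (x′ᵢ 2F y - x′ᵢ 1F y) ≡ (B ·ᵥ (λ j → zᵢ 2F j - zᵢ 1F j)) y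
    first y = begin
      (xᵢ 2F y - xᵢ 1F y) - (x′ᵢ 2F y - x′ᵢ 1F y)   ≡⟨ ring (xᵢ 2F y) (xᵢ 1F y) (x′ᵢ 2F y) (x′ᵢ 1F y) ⟩
      (xᵢ 2F y - x′ᵢ 2F y) - (xᵢ 1F y - x′ᵢ 1F y)   ≡⟨ cong₂ _-_ (Δ≡ 2F y) (Δ≡ 1F y) ⟩
      (Bz 2F y - s y) - (Bz 1F y - s y)             ≡⟨ ring′ (Bz 2F y) (Bz 1F y) (s y) ⟩
      Bz 2F y - Bz 1F y                             ≡⟨ ·ᵥ-distrib-- B (zᵢ 2F) (zᵢ 1F) y ⟨
      (B ·ᵥ (λ j → zᵢ 2F j - zᵢ 1F j)) y            ∎
      where
      ring : ∀ a b a′ b′ → (a - b) - (a′ - b′) ≡ (a - a′) - (b - b′)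
      ring = solve-∀
      ring′ : ∀ a b s → (a - s) - (b - s) ≡ a - b
      ring′ = solve-∀
    BΔ₁ : ∀ y → (B ·ᵥ xᵢ 1F) y - (B ·ᵥ x′ᵢ 1F) y ≡ (B ·ᵥ Bz 1F) y - (Bz 0F y + Bz 1F y + Bz 2F y)
    BΔ₁ y = begin
      (B ·ᵥ xᵢ 1F) y - (B ·ᵥ x′ᵢ 1F) y             ≡⟨ ·ᵥ-distrib-- B (xᵢ 1F) (x′ᵢ 1F) y ⟨
      (B ·ᵥ (λ j → xᵢ 1F j - x′ᵢ 1F j)) y          ≡⟨ ·ᵥ-cong B (Δ≡ 1F) y ⟩
      (B ·ᵥ (λ j → Bz 1F j - s j)) y               ≡⟨ ·ᵥ-distrib-- B (Bz 1F) s y ⟩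
      (B ·ᵥ Bz 1F) y - (B ·ᵥ s) y                  ≡⟨ cong (_-_ ((B ·ᵥ Bz 1F) y)) (·ᵥ-blockSum z y) ⟩
      (B ·ᵥ Bz 1F) y - (Bz 0F y + Bz 1F y + Bz 2F y) ∎
    second : ∀ y → proj₂ (toPair x) y - proj₂ (toPair x′) y ≡ (C ·ᵥ zᵢ 1F) y
    second y = begin
      (blockSum x y + (B ·ᵥ xᵢ 1F) y - + 3 * xᵢ 1F y) - (blockSum x′ y + (B ·ᵥ x′ᵢ 1F) y - + 3 * x′ᵢ 1F y)
        ≡⟨ ring (xᵢ 0F y) (xᵢ 1F y) (xᵢ 2F y) ((B ·ᵥ xᵢ 1F) y) (x′ᵢ 0F y) (x′ᵢ 1F y) (x′ᵢ 2F y) ((B ·ᵥ x′ᵢ 1F) y) ⟩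
      (xᵢ 0F y - x′ᵢ 0F y) + (xᵢ 1F y - x′ᵢ 1F y) + (xᵢ 2F y - x′ᵢ 2F y)
        + ((B ·ᵥ xᵢ 1F) y - (B ·ᵥ x′ᵢ 1F) y) - + 3 * (xᵢ 1F y - x′ᵢ 1F y)
        ≡⟨ cong₂ _-_ (cong₂ _+_ (cong₂ _+_ (cong₂ _+_ (Δ≡ 0F y) (Δ≡ 1F y)) (Δ≡ 2F y)) (BΔ₁ y))
                     (cong (_*_ (+ 3)) (Δ≡ 1F y)) ⟩
      (Bz 0F y - s y) + (Bz 1F y - s y) + (Bz 2F y - s y)
        + ((B ·ᵥ Bz 1F) y - (Bz 0F y + Bz 1F y + Bz 2F y)) - + 3 * (Bz 1F y - s y)
        ≡⟨ ring′ (Bz 0F y) (Bz 1F y) (Bz 2F y) ((B ·ᵥ Bz 1F) y) (s y) ⟩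
      (B ·ᵥ Bz 1F) y - + 3 * Bz 1F y
        ≡⟨ C-·ᵥ (zᵢ 1F) y ⟨
      (C ·ᵥ zᵢ 1F) y ∎
      where
      ring : ∀ a₀ a₁ a₂ Ba₁ b₀ b₁ b₂ Bb₁ →
        (a₀ + a₁ + a₂ + Ba₁ - + 3 * a₁) - (b₀ + b₁ + b₂ + Bb₁ - + 3 * b₁) ≡
        (a₀ - b₀) + (a₁ - b₁) + (a₂ - b₂) + (Ba₁ - Bb₁) - + 3 * (a₁ - b₁)
      ring = solve-∀
      ring′ : ∀ c₀ c₁ c₂ BBz₁ s →
        (c₀ - s) + (c₁ - s) + (c₂ - s) + (BBz₁ - (c₀ + c₁ + c₂)) - + 3 * (c₁ - s) ≡ BBz₁ - + 3 * c₁
      ring′ = solve-∀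

  fromPair-cong : ∀ {p p′} → p ≈ᴾ p′ → fromPair p ≈[ L ] fromPair p′
  fromPair-cong {u , v} {u′ , v′} ((w , Δu≡) , (w′ , Δv≡)) =
    ≈ᴸ-intro {fromPair (u , v)} {fromPair (u′ , v′)} z₀ w′ (λ j → w′ j + w j) blockwise
    where
    open ≡-Reasoning
    Bw = B ·ᵥ w
    Bw′ = B ·ᵥ w′
    z₀ : IVec n
    z₀ j = Bw′ j - + 2 * w′ j - w j
    Bz₀ : ∀ y → (B ·ᵥ z₀) y ≡ (B ·ᵥ Bw′) y - + 2 * Bw′ y - Bw y
    Bz₀ y = begin
      (B ·ᵥ z₀) y
        ≡⟨ ·ᵥ-distrib-- B (λ j → Bw′ j - + 2 * w′ j) w y ⟩
      (B ·ᵥ (λ j → Bw′ j - + 2 * w′ j)) y - Bw y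
        ≡⟨ cong (_- Bw y) (·ᵥ-distrib-- B Bw′ (λ j → + 2 * w′ j) y) ⟩
      (B ·ᵥ Bw′) y - (B ·ᵥ (λ j → + 2 * w′ j)) y - Bw y
        ≡⟨ cong (λ t → (B ·ᵥ Bw′) y - t - Bw y) (·ᵥ-*ˡ B (+ 2) w′ y) ⟩
      (B ·ᵥ Bw′) y - + 2 * Bw′ y - Bw y ∎
    blockwise : ∀ x y → block (fromPair (u , v)) x y - block (fromPair (u′ , v′)) x y ≡
                (B ·ᵥ blocks z₀ w′ (λ j → w′ j + w j) x) y - (z₀ y + w′ y + (w′ y + w y))
    blockwise 0F y = begin
      block (fromPair (u , v)) 0F y - block (fromPair (u′ , v′)) 0F y
        ≡⟨ cong₂ _-_ (block-fromPair (u , v) 0F y) (block-fromPair (u′ , v′) 0F y) ⟩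
      (v y - u y) - (v′ y - u′ y)               ≡⟨ ring (v y) (u y) (v′ y) (u′ y) ⟩
      (v y - v′ y) - (u y - u′ y)               ≡⟨ cong₂ _-_ (trans (Δv≡ y) (C-·ᵥ w′ y)) (Δu≡ y) ⟩
      (B ·ᵥ Bw′) y - + 3 * Bw′ y - Bw y          ≡⟨ ring′ ((B ·ᵥ Bw′) y) (Bw′ y) (Bw y) (w′ y) (w y) ⟩
      ((B ·ᵥ Bw′) y - + 2 * Bw′ y - Bw y) - (z₀ y + w′ y + (w′ y + w y))
        ≡⟨ cong (_- (z₀ y + w′ y + (w′ y + w y))) (Bz₀ y) ⟨
      (B ·ᵥ z₀) y - (z₀ y + w′ y + (w′ y + w y)) ∎
      where
      ring : ∀ a b a′ b′ → (a - b) - (a′ - b′) ≡ (a - a′) - (b - b′)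
      ring = solve-∀
      ring′ : ∀ BBw′ Bw′ Bw w′ w → BBw′ - + 3 * Bw′ - Bw ≡
               (BBw′ - + 2 * Bw′ - Bw) - ((Bw′ - + 2 * w′ - w) + w′ + (w′ + w))
      ring′ = solve-∀
    blockwise 1F y = begin
      block (fromPair (u , v)) 1F y - block (fromPair (u′ , v′)) 1F y
        ≡⟨ cong₂ _-_ (block-fromPair (u , v) 1F y) (block-fromPair (u′ , v′) 1F y) ⟩
      0ℤ - 0ℤ                                     ≡⟨ ring (Bw′ y) (w′ y) (w y) ⟩
      Bw′ y - (z₀ y + w′ y + (w′ y + w y))        ∎
      where
      ring : ∀ Bw′ w′ w → 0ℤ - 0ℤ ≡ Bw′ - ((Bw′ - + 2 * w′ - w) + w′ + (w′ + w))
      ring = solve-∀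
    blockwise 2F y = begin
      block (fromPair (u , v)) 2F y - block (fromPair (u′ , v′)) 2F y
        ≡⟨ cong₂ _-_ (block-fromPair (u , v) 2F y) (block-fromPair (u′ , v′) 2F y) ⟩
      u y - u′ y                                  ≡⟨ Δu≡ y ⟩
      Bw y                                        ≡⟨ ring (Bw′ y) (Bw y) (w′ y) (w y) ⟩
      (Bw′ y + Bw y) - (z₀ y + w′ y + (w′ y + w y))
        ≡⟨ cong (_- (z₀ y + w′ y + (w′ y + w y))) (·ᵥ-distrib-+ B w′ w y) ⟨
      (B ·ᵥ (λ j → w′ j + w j)) y - (z₀ y + w′ y + (w′ y + w y)) ∎
      where
      ring : ∀ Bw′ Bw w′ w → Bw ≡ (Bw′ + Bw) - ((Bw′ - + 2 * w′ - w) + w′ + (w′ + w))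
      ring = solve-∀

  toPair-homo : ∀ x x′ → toPair (λ q → x q + x′ q) ≈ᴾ
    ((λ j → proj₁ (toPair x) j + proj₁ (toPair x′) j) , (λ j → proj₂ (toPair x) j + proj₂ (toPair x′) j))
  toPair-homo x x′ = ≗⇒≈ B (λ y → ring (xᵢ 1F y) (xᵢ 2F y) (x′ᵢ 1F y) (x′ᵢ 2F y))
                   , ≗⇒≈ C λ y → begin
    blockSum (λ q → x q + x′ q) y + (B ·ᵥ (λ j → xᵢ 1F j + x′ᵢ 1F j)) y - + 3 * (xᵢ 1F y + x′ᵢ 1F y)
      ≡⟨ cong (λ t → blockSum (λ q → x q + x′ q) y + t - + 3 * (xᵢ 1F y + x′ᵢ 1F y))
              (·ᵥ-distrib-+ B (xᵢ 1F) (x′ᵢ 1F) y) ⟩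
    blockSum (λ q → x q + x′ q) y + ((B ·ᵥ xᵢ 1F) y + (B ·ᵥ x′ᵢ 1F) y) - + 3 * (xᵢ 1F y + x′ᵢ 1F y)
      ≡⟨ ring′ (xᵢ 0F y) (xᵢ 1F y) (xᵢ 2F y) ((B ·ᵥ xᵢ 1F) y) (x′ᵢ 0F y) (x′ᵢ 1F y) (x′ᵢ 2F y) ((B ·ᵥ x′ᵢ 1F) y) ⟩
    proj₂ (toPair x) y + proj₂ (toPair x′) y ∎
    where
    open ≡-Reasoning
    xᵢ = block x
    x′ᵢ = block x′
    ring : ∀ a₁ a₂ b₁ b₂ → (a₂ + b₂) - (a₁ + b₁) ≡ (a₂ - a₁) + (b₂ - b₁)
    ring = solve-∀
    ring′ : ∀ a₀ a₁ a₂ Ba₁ b₀ b₁ b₂ Bb₁ →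
      (a₀ + b₀) + (a₁ + b₁) + (a₂ + b₂) + (Ba₁ + Bb₁) - + 3 * (a₁ + b₁) ≡
      (a₀ + a₁ + a₂ + Ba₁ - + 3 * a₁) + (b₀ + b₁ + b₂ + Bb₁ - + 3 * b₁)
    ring′ = solve-∀

  toPair-fromPair : ∀ p → toPair (fromPair p) ≈ᴾ p
  toPair-fromPair (u , v) = ≗⇒≈ B first , ≗⇒≈ C second
    where
    open ≡-Reasoning
    first : ∀ y → block (fromPair (u , v)) 2F y - block (fromPair (u , v)) 1F y ≡ u y
    first y = trans (cong₂ _-_ (block-fromPair (u , v) 2F y) (block-fromPair (u , v) 1F y)) (ℤ.+-identityʳ (u y))
    B·block₁≡0 : ∀ y → (B ·ᵥ block (fromPair (u , v)) 1F) y ≡ 0ℤ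
    B·block₁≡0 y = trans (·ᵥ-cong B (block-fromPair (u , v) 1F) y) (·ᵥ-zeroʳ B y)
    second : ∀ y → proj₂ (toPair (fromPair (u , v))) y ≡ v y
    second y = begin
      proj₂ (toPair (fromPair (u , v))) y
        ≡⟨ cong₂ (λ s t → s + t - + 3 * block (fromPair (u , v)) 1F y)
                 (blockSum-fromBlocks (blocks (λ y → v y - u y) (λ _ → 0ℤ) u) y) (B·block₁≡0 y) ⟩
      (v y - u y) + 0ℤ + u y + 0ℤ - + 3 * block (fromPair (u , v)) 1F y
        ≡⟨ cong (λ t → (v y - u y) + 0ℤ + u y + 0ℤ - + 3 * t) (block-fromPair (u , v) 1F y) ⟩
      (v y - u y) + 0ℤ + u y + 0ℤ - + 3 * 0ℤ  ≡⟨ ring (u y) (v y) ⟩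
      v y                                     ∎
      where
      ring : ∀ u v → (v - u) + 0ℤ + u + 0ℤ - + 3 * 0ℤ ≡ v
      ring = solve-∀

  fromPair-toPair : ∀ x → fromPair (toPair x) ≈[ L ] x
  fromPair-toPair x = ≈ᴸ-intro {fromPair (toPair x)} {x} (xᵢ 1F) (λ _ → 0ℤ) (λ _ → 0ℤ) blockwise
    where
    open ≡-Reasoning
    xᵢ = block x
    blockwise : ∀ i y → block (fromPair (toPair x)) i y - xᵢ i y ≡
                (B ·ᵥ blocks (xᵢ 1F) (λ _ → 0ℤ) (λ _ → 0ℤ) i) y - (xᵢ 1F y + 0ℤ + 0ℤ)
    blockwise 0F y = begin
      block (fromPair (toPair x)) 0F y - xᵢ 0F y  ≡⟨ cong (_- xᵢ 0F y) (block-fromPair (toPair x) 0F y) ⟩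
      (xᵢ 0F y + xᵢ 1F y + xᵢ 2F y + (B ·ᵥ xᵢ 1F) y - + 3 * xᵢ 1F y - (xᵢ 2F y - xᵢ 1F y)) - xᵢ 0F y
        ≡⟨ ring (xᵢ 0F y) (xᵢ 1F y) (xᵢ 2F y) ((B ·ᵥ xᵢ 1F) y) ⟩
      (B ·ᵥ xᵢ 1F) y - (xᵢ 1F y + 0ℤ + 0ℤ)         ∎
      where
      ring : ∀ x₀ x₁ x₂ Bx₁ → (x₀ + x₁ + x₂ + Bx₁ - + 3 * x₁ - (x₂ - x₁)) - x₀ ≡ Bx₁ - (x₁ + 0ℤ + 0ℤ)
      ring = solve-∀
    blockwise 1F y = begin
      block (fromPair (toPair x)) 1F y - xᵢ 1F y  ≡⟨ cong (_- xᵢ 1F y) (block-fromPair (toPair x) 1F y) ⟩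
      0ℤ - xᵢ 1F y                               ≡⟨ ring (xᵢ 1F y) ⟩
      0ℤ - (xᵢ 1F y + 0ℤ + 0ℤ)                   ≡⟨ cong (_- (xᵢ 1F y + 0ℤ + 0ℤ)) (·ᵥ-zeroʳ B y) ⟨
      (B ·ᵥ (λ _ → 0ℤ)) y - (xᵢ 1F y + 0ℤ + 0ℤ)  ∎
      where
      ring : ∀ x₁ → 0ℤ - x₁ ≡ 0ℤ - (x₁ + 0ℤ + 0ℤ)
      ring = solve-∀
    blockwise 2F y = begin
      block (fromPair (toPair x)) 2F y - xᵢ 2F y  ≡⟨ cong (_- xᵢ 2F y) (block-fromPair (toPair x) 2F y) ⟩
      (xᵢ 2F y - xᵢ 1F y) - xᵢ 2F y              ≡⟨ ring (xᵢ 1F y) (xᵢ 2F y) ⟩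
      0ℤ - (xᵢ 1F y + 0ℤ + 0ℤ)                   ≡⟨ cong (_- (xᵢ 1F y + 0ℤ + 0ℤ)) (·ᵥ-zeroʳ B y) ⟨
      (B ·ᵥ (λ _ → 0ℤ)) y - (xᵢ 1F y + 0ℤ + 0ℤ)  ∎
      where
      ring : ∀ x₁ x₂ → (x₂ - x₁) - x₂ ≡ 0ℤ - (x₁ + 0ℤ + 0ℤ)
      ring = solve-∀

  coker-≅ : coker L ≅ abelianGroup (coker B) (coker C)
  coker-≅ = inverse⇒≅ {G = coker L} {abelianGroup (coker B) (coker C)} toPair fromPair
                      (λ {x} {x′} → toPair-cong {x} {x′}) (λ {p} {p′} → fromPair-cong {p} {p′})
                      toPair-homo toPair-fromPair fromPair-toPair


-- Residues modulo n and the cyclic shift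

module _ {n : ℕ} .{{_ : NonZero n}} where
  open ≡-Reasoning

  [m%n+k]%n≡[m+k]%n : ∀ m k → (m % n ℕ.+ k) % n ≡ (m ℕ.+ k) % n
  [m%n+k]%n≡[m+k]%n m k = begin
    (m % n ℕ.+ k) % n          ≡⟨ %-distribˡ-+ (m % n) k n ⟩
    (m % n % n ℕ.+ k % n) % n  ≡⟨ cong (λ t → (t ℕ.+ k % n) % n) (m%n%n≡m%n m n) ⟩
    (m % n ℕ.+ k % n) % n      ≡⟨ %-distribˡ-+ m k n ⟨
    (m ℕ.+ k) % n              ∎

  [k+m%n]%n≡[k+m]%n : ∀ k m → (k ℕ.+ m % n) % n ≡ (k ℕ.+ m) % n
  [k+m%n]%n≡[k+m]%n k m = begin
    (k ℕ.+ m % n) % n  ≡⟨ cong (_% n) (ℕ.+-comm k (m % n)) ⟩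
    (m % n ℕ.+ k) % n  ≡⟨ [m%n+k]%n≡[m+k]%n m k ⟩
    (m ℕ.+ k) % n      ≡⟨ cong (_% n) (ℕ.+-comm m k) ⟩
    (k ℕ.+ m) % n      ∎

  -- (b + (n ∸ a)) % n is the residue of b − a, as in the definition of circ.
  [a+k]%n≡b⇒[b+[n∸a]]%n≡k : ∀ {a b k} → a ≤ n → k < n → (a ℕ.+ k) % n ≡ b → (b ℕ.+ (n ∸ a)) % n ≡ k
  [a+k]%n≡b⇒[b+[n∸a]]%n≡k {a} {b} {k} a≤n k<n refl = begin
    ((a ℕ.+ k) % n ℕ.+ (n ∸ a)) % n  ≡⟨ [m%n+k]%n≡[m+k]%n (a ℕ.+ k) (n ∸ a) ⟩
    (a ℕ.+ k ℕ.+ (n ∸ a)) % n        ≡⟨ cong (_% n) (trans (cong (ℕ._+ (n ∸ a)) (ℕ.+-comm a k)) (ℕ.+-assoc k a (n ∸ a))) ⟩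
    (k ℕ.+ (a ℕ.+ (n ∸ a))) % n      ≡⟨ cong (λ t → (k ℕ.+ t) % n) (ℕ.m+[n∸m]≡n a≤n) ⟩
    (k ℕ.+ n) % n                    ≡⟨ [m+n]%n≡m%n k n ⟩
    k % n                            ≡⟨ m<n⇒m%n≡m k<n ⟩
    k                                ∎

  [b+[n∸a]]%n≡k⇒[a+k]%n≡b : ∀ {a b k} → a ≤ n → b < n → (b ℕ.+ (n ∸ a)) % n ≡ k → (a ℕ.+ k) % n ≡ b
  [b+[n∸a]]%n≡k⇒[a+k]%n≡b {a} {b} a≤n b<n refl = begin
    (a ℕ.+ (b ℕ.+ (n ∸ a)) % n) % n  ≡⟨ [k+m%n]%n≡[k+m]%n a (b ℕ.+ (n ∸ a)) ⟩
    (a ℕ.+ (b ℕ.+ (n ∸ a))) % n      ≡⟨ cong (_% n) (ℕ.+-comm a (b ℕ.+ (n ∸ a))) ⟩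
    (b ℕ.+ (n ∸ a) ℕ.+ a) % n        ≡⟨ cong (_% n) (trans (ℕ.+-assoc b (n ∸ a) a) (cong (b ℕ.+_) (ℕ.m∸n+n≡m a≤n))) ⟩
    (b ℕ.+ n) % n                    ≡⟨ [m+n]%n≡m%n b n ⟩
    b % n                            ≡⟨ m<n⇒m%n≡m b<n ⟩
    b                                ∎

indicator-∨ : ∀ b₁ b₂ → ¬ (T b₁ × T b₂) → indicator (b₁ ∨ b₂) ≡ indicator b₁ + indicator b₂
indicator-∨ true  true  ¬both = contradiction (_ , _) ¬both
indicator-∨ true  false _     = refl
indicator-∨ false b₂    _     = sym (ℤ.+-identityˡ (indicator b₂))

does≡⌊⌋ : ∀ {a b} {A : Set a} {B : Set b} → A ⇔ B → (a? : Dec A) (b? : Dec B) → does a? ≡ ⌊ b? ⌋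
does≡⌊⌋ A⇔B a? b? = trans (does-⇔ A⇔B a? b?) (sym (isYes≗does b?))

module Cyclic {n : ℕ} .{{_ : NonZero n}} where
  open ≡-Reasoning

  sucMod predMod : Fin n → Fin n
  sucMod y = (toℕ y ℕ.+ 1) mod n
  predMod y = (toℕ y ℕ.+ (n ∸ 1)) mod n

  toℕ-mod : ∀ m → toℕ (m mod n) ≡ m % n
  toℕ-mod m = toℕ-fromℕ< (m%n<n m n)

  private
    1≤n : 1 ≤ n
    1≤n = ℕ.>-nonZero⁻¹ n

  sucMod-predMod : ∀ y → sucMod (predMod y) ≡ y
  sucMod-predMod y = toℕ-injective (begin
    toℕ (sucMod (predMod y))           ≡⟨ toℕ-mod (toℕ (predMod y) ℕ.+ 1) ⟩
    (toℕ (predMod y) ℕ.+ 1) % n        ≡⟨ cong (_% n) (ℕ.+-comm (toℕ (predMod y)) 1) ⟩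
    (1 ℕ.+ toℕ (predMod y)) % n        ≡⟨ [b+[n∸a]]%n≡k⇒[a+k]%n≡b 1≤n (toℕ<n y) (sym (toℕ-mod _)) ⟩
    toℕ y                              ∎)

  predMod-sucMod : ∀ y → predMod (sucMod y) ≡ y
  predMod-sucMod y = toℕ-injective (begin
    toℕ (predMod (sucMod y))           ≡⟨ toℕ-mod (toℕ (sucMod y) ℕ.+ (n ∸ 1)) ⟩
    (toℕ (sucMod y) ℕ.+ (n ∸ 1)) % n   ≡⟨ [a+k]%n≡b⇒[b+[n∸a]]%n≡k 1≤n (toℕ<n y) 1+y%n≡sucMod ⟩
    toℕ y                              ∎)
    where
    1+y%n≡sucMod : (1 ℕ.+ toℕ y) % n ≡ toℕ (sucMod y)
    1+y%n≡sucMod = trans (cong (_% n) (ℕ.+-comm 1 (toℕ y))) (sym (toℕ-mod _))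

  sucMod≡⇔predMod≡ : ∀ y y′ → sucMod y ≡ y′ ⇔ predMod y′ ≡ y
  sucMod≡⇔predMod≡ y y′ = mk⇔ (λ eq → trans (cong predMod (sym eq)) (predMod-sucMod y))
                              (λ eq → trans (cong sucMod (sym eq)) (sucMod-predMod y′))

  shiftT-sucMod : 1 < n → ∀ y y′ → shiftT y y′ ≡ Id (sucMod y) y′
  shiftT-sucMod 1<n y y′ = cong indicator (does≡⌊⌋ shift≡1⇔ (toℕ diff ℕ.≟ 1) (sucMod y ≟ y′))
    where
    diff = (toℕ y′ ℕ.+ (n ∸ toℕ y)) mod n
    shift≡1⇔ : toℕ diff ≡ 1 ⇔ sucMod y ≡ y′
    shift≡1⇔ = mk⇔
      (λ diff≡1 → toℕ-injective (trans (toℕ-mod _)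
        ([b+[n∸a]]%n≡k⇒[a+k]%n≡b (ℕ.<⇒≤ (toℕ<n y)) (toℕ<n y′) (trans (sym (toℕ-mod _)) diff≡1))))
      (λ eq → trans (toℕ-mod _) ([a+k]%n≡b⇒[b+[n∸a]]%n≡k (ℕ.<⇒≤ (toℕ<n y)) 1<n
                                   (trans (sym (toℕ-mod _)) (cong toℕ eq))))

  sucMod∘sucMod≢id : 2 < n → ∀ y → sucMod (sucMod y) ≢ y
  sucMod∘sucMod≢id 2<n y σσy≡y = 0≢2 (begin
    0                               ≡⟨ n%n≡0 n ⟨
    n % n                           ≡⟨ cong (_% n) (ℕ.m+[n∸m]≡n (ℕ.<⇒≤ (toℕ<n y))) ⟨
    (toℕ y ℕ.+ (n ∸ toℕ y)) % n     ≡⟨ [a+k]%n≡b⇒[b+[n∸a]]%n≡k (ℕ.<⇒≤ (toℕ<n y)) 2<n y+2%n≡y ⟩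
    2                               ∎)
    where
    0≢2 : 0 ≢ 2
    0≢2 ()
    y+2%n≡y : (toℕ y ℕ.+ 2) % n ≡ toℕ y
    y+2%n≡y = begin
      (toℕ y ℕ.+ 2) % n              ≡⟨ cong (_% n) (ℕ.+-assoc (toℕ y) 1 1) ⟨
      (toℕ y ℕ.+ 1 ℕ.+ 1) % n        ≡⟨ [m%n+k]%n≡[m+k]%n (toℕ y ℕ.+ 1) 1 ⟨
      ((toℕ y ℕ.+ 1) % n ℕ.+ 1) % n  ≡⟨ cong (λ t → (t ℕ.+ 1) % n) (toℕ-mod _) ⟨
      (toℕ (sucMod y) ℕ.+ 1) % n     ≡⟨ toℕ-mod _ ⟨
      toℕ (sucMod (sucMod y))        ≡⟨ cong toℕ σσy≡y ⟩
      toℕ y                          ∎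

  sucMod-≡ᵇ : ∀ y y′ → ((toℕ y ℕ.+ 1) % n ≡ᵇ toℕ y′) ≡ ⌊ sucMod y ≟ y′ ⌋
  sucMod-≡ᵇ y y′ = does≡⌊⌋ (mk⇔ (λ eq → toℕ-injective (trans (toℕ-mod _) eq))
                                (λ eq → trans (sym (toℕ-mod _)) (cong toℕ eq)))
                           ((toℕ y ℕ.+ 1) % n ℕ.≟ toℕ y′) (sucMod y ≟ y′)

  module _ (1<n : 1 < n) (Tinv : Matrix n) (T⊗Tinv≡I : (shiftT ⊗ Tinv) ≡ₘ Id) where

    Tinv-predMod : ∀ y y′ → Tinv y y′ ≡ Id (predMod y) y′
    Tinv-predMod y y′ = begin
      Tinv y y′                                   ≡⟨ cong (λ t → Tinv t y′) (sucMod-predMod y) ⟨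
      Tinv (sucMod x) y′                          ≡⟨ Id-·ᵥ (λ k → Tinv k y′) (sucMod x) ⟨
      sum (λ k → Id (sucMod x) k * Tinv k y′)     ≡⟨ sum-cong-≗ (λ k → cong (_* Tinv k y′) (shiftT-sucMod 1<n x k)) ⟨
      (shiftT ⊗ Tinv) x y′                        ≡⟨ T⊗Tinv≡I x y′ ⟩
      Id x y′                                     ∎
      where x = predMod y

    cycAdj-indicator : 2 < n → ∀ y y′ → indicator (cycAdj y y′) ≡ shiftT y y′ + Tinv y y′
    cycAdj-indicator 2<n y y′ = begin
      indicator (cycAdj y y′)
        ≡⟨ cong indicator (cong₂ _∨_ (sucMod-≡ᵇ y y′) predMod-≡ᵇ) ⟩
      indicator (⌊ sucMod y ≟ y′ ⌋ ∨ ⌊ predMod y ≟ y′ ⌋)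
        ≡⟨ indicator-∨ ⌊ sucMod y ≟ y′ ⌋ ⌊ predMod y ≟ y′ ⌋ (λ (σy≡y′ , πy≡y′) →
             sucMod∘sucMod≢id 2<n y (trans (cong sucMod (toWitness σy≡y′))
                                            (trans (cong sucMod (sym (toWitness πy≡y′))) (sucMod-predMod y)))) ⟩
      Id (sucMod y) y′ + Id (predMod y) y′
        ≡⟨ cong₂ _+_ (shiftT-sucMod 1<n y y′) (Tinv-predMod y y′) ⟨
      shiftT y y′ + Tinv y y′ ∎
      where
      open Equivalence (sucMod≡⇔predMod≡ y′ y)
      predMod-≡ᵇ : ((toℕ y′ ℕ.+ 1) % n ≡ᵇ toℕ y) ≡ ⌊ predMod y ≟ y′ ⌋
      predMod-≡ᵇ = does≡⌊⌋ (mk⇔ (λ eq → to (toℕ-injective (trans (toℕ-mod _) eq)))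
                                (λ eq → trans (sym (toℕ-mod _)) (cong toℕ (from eq))))
                           ((toℕ y′ ℕ.+ 1) % n ℕ.≟ toℕ y) (predMod y ≟ y′)

    Tinv-·ᵥ : ∀ w → Tinv ·ᵥ w ≗ w ∘ predMod
    Tinv-·ᵥ w y = trans (sum-cong-≗ (λ y′ → cong (_* w y′) (Tinv-predMod y y′))) (Id-·ᵥ w (predMod y))

  shiftT-·ᵥ : 1 < n → ∀ w → shiftT ·ᵥ w ≗ w ∘ sucMod
  shiftT-·ᵥ 1<n w y = trans (sum-cong-≗ (λ y′ → cong (_* w y′) (shiftT-sucMod 1<n y y′))) (Id-·ᵥ w (sucMod y))

-- Graph Laplacians and the graph Δ(n;1,1,1)

adjacency : (Fin r → Fin r → Bool) → Matrix r
adjacency adj u v = indicator (adj u v)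

degree-adjacency : ∀ (adj : Fin r → Fin r → Bool) u → degree adj u ≡ (adjacency adj ·ᵥ (λ _ → 1ℤ)) u
degree-adjacency adj u = sum-cong-≗ (λ v → sym (ℤ.*-identityʳ (indicator (adj u v))))

laplacian-·ᵥ : ∀ (adj : Fin r → Fin r → Bool) z u →
  (laplacian adj ·ᵥ z) u ≡ degree adj u * z u - (adjacency adj ·ᵥ z) u
laplacian-·ᵥ adj z u = begin
  sum (λ v → ((if ⌊ u ≟ v ⌋ then d else 0ℤ) - indicator (adj u v)) * z v)
    ≡⟨ sum-cong-≗ (λ v → diagonal-* ⌊ u ≟ v ⌋ (indicator (adj u v)) (z v)) ⟩
  sum (λ v → (if ⌊ u ≟ v ⌋ then d * z v else 0ℤ) - indicator (adj u v) * z v)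
    ≡⟨ sum-distrib-- (λ v → if ⌊ u ≟ v ⌋ then d * z v else 0ℤ) (λ v → indicator (adj u v) * z v) ⟩
  sum (λ v → if ⌊ u ≟ v ⌋ then d * z v else 0ℤ) - (adjacency adj ·ᵥ z) u
    ≡⟨ cong (_- (adjacency adj ·ᵥ z) u) (sum-δ u (λ v → d * z v)) ⟩
  d * z u - (adjacency adj ·ᵥ z) u ∎
  where
  open ≡-Reasoning
  d = degree adj u
  diagonal-* : ∀ b a x → ((if b then d else 0ℤ) - a) * x ≡ (if b then d * x else 0ℤ) - a * x
  diagonal-* true  a x = ring d a x
    where
    ring : ∀ d a x → (d - a) * x ≡ d * x - a * x
    ring = solve-∀
  diagonal-* false a x = ring a x
    where
    ring : ∀ a x → (0ℤ - a) * x ≡ 0ℤ - a * x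
    ring = solve-∀

A⟨_⟩ : ∀ {n} .{{_ : NonZero n}} → Matrix n → Matrix n
A⟨ Tinv ⟩ = ((+ 4) ⊛ Id) ⊕ ((⊝ shiftT) ⊕ (⊝ Tinv))

module Δ (n : ℕ) .{{_ : NonZero n}} (2<n : 2 < n) (Tinv : Matrix n) (T⊗Tinv≡I : (shiftT ⊗ Tinv) ≡ₘ Id) where
  open Blocks n
  open Cyclic
  open ≡-Reasoning

  private
    1<n : 1 < n
    1<n = ℕ.<-trans (ℕ.n<1+n 1) 2<n

  adjacency-combine : ∀ x x′ y y′ →
    adjacency (ΔAdj n) (combine x y) (combine x′ y′) ≡ (if ⌊ x ≟ x′ ⌋ then shiftT ⊕ Tinv else Id) y y′
  adjacency-combine x x′ y y′ = begin
    indicator (ΔAdj' (remQuot n (combine x y)) (remQuot n (combine x′ y′)))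
      ≡⟨ cong₂ (λ p q → indicator (ΔAdj' p q)) (remQuot-combine x y) (remQuot-combine x′ y′) ⟩
    indicator ((⌊ x ≟ x′ ⌋ ∧ cycAdj y y′) ∨ (⌊ y ≟ y′ ⌋ ∧ not ⌊ x ≟ x′ ⌋))
      ≡⟨ by-layer ⌊ x ≟ x′ ⌋ ⟩
    (if ⌊ x ≟ x′ ⌋ then shiftT ⊕ Tinv else Id) y y′ ∎
    where
    by-layer : ∀ b → indicator ((b ∧ cycAdj y y′) ∨ (⌊ y ≟ y′ ⌋ ∧ not b)) ≡ (if b then shiftT ⊕ Tinv else Id) y y′
    by-layer true  = trans (cong indicator (trans (cong (cycAdj y y′ ∨_) (∧-zeroʳ _)) (∨-identityʳ _)))
                           (cycAdj-indicator 1<n Tinv T⊗Tinv≡I 2<n y y′)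
    by-layer false = cong indicator (∧-identityʳ _)

  adjacency-·ᵥ : ∀ z x y →
    (adjacency (ΔAdj n) ·ᵥ z) (combine x y) ≡ ((shiftT ⊕ Tinv) ·ᵥ block z x) y - block z x y + blockSum z y
  adjacency-·ᵥ z x y = begin
    (adjacency (ΔAdj n) ·ᵥ z) (combine x y)
      ≡⟨ sum-combine 3 n (λ q → adjacency (ΔAdj n) (combine x y) q * z q) ⟩
    sum (λ x′ → sum (λ y′ → adjacency (ΔAdj n) (combine x y) (combine x′ y′) * block z x′ y′))
      ≡⟨ sum-cong-≗ (λ x′ → sum-cong-≗ (λ y′ → cong (_* block z x′ y′) (adjacency-combine x x′ y y′))) ⟩
    sum (λ x′ → ((if ⌊ x ≟ x′ ⌋ then shiftT ⊕ Tinv else Id) ·ᵥ block z x′) y)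
      ≡⟨ sum-cong-≗ (λ x′ → trans (if-float (λ M → (M ·ᵥ block z x′) y) ⌊ x ≟ x′ ⌋ {shiftT ⊕ Tinv} {Id})
                                  (if-cong-else ⌊ x ≟ x′ ⌋ (Id-·ᵥ (block z x′) y))) ⟩
    sum (λ x′ → if ⌊ x ≟ x′ ⌋ then ((shiftT ⊕ Tinv) ·ᵥ block z x′) y else block z x′ y)
      ≡⟨ sum-select x (λ x′ → ((shiftT ⊕ Tinv) ·ᵥ block z x′) y) (λ x′ → block z x′ y) ⟩
    ((shiftT ⊕ Tinv) ·ᵥ block z x) y - block z x y + sum (λ x′ → block z x′ y)
      ≡⟨ cong (_+_ (((shiftT ⊕ Tinv) ·ᵥ block z x) y - block z x y)) (ring (block z 0F y) (block z 1F y) (block z 2F y)) ⟩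
    ((shiftT ⊕ Tinv) ·ᵥ block z x) y - block z x y + blockSum z y ∎
    where
    ring : ∀ a b c → a + (b + (c + 0ℤ)) ≡ a + b + c
    ring = solve-∀

  degree-combine : ∀ x y → degree (ΔAdj n) (combine x y) ≡ + 4
  degree-combine x y = begin
    degree (ΔAdj n) (combine x y)                           ≡⟨ degree-adjacency (ΔAdj n) (combine x y) ⟩
    (adjacency (ΔAdj n) ·ᵥ (λ _ → 1ℤ)) (combine x y)         ≡⟨ adjacency-·ᵥ (λ _ → 1ℤ) x y ⟩
    ((shiftT ⊕ Tinv) ·ᵥ (λ _ → 1ℤ)) y - 1ℤ + (1ℤ + 1ℤ + 1ℤ) ≡⟨ cong (λ t → t - 1ℤ + (1ℤ + 1ℤ + 1ℤ)) row-sum ⟩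
    + 4                                                     ∎
    where
    row-sum : ((shiftT ⊕ Tinv) ·ᵥ (λ _ → 1ℤ)) y ≡ + 2
    row-sum = trans (⊕-·ᵥ shiftT Tinv (λ _ → 1ℤ) y)
                    (cong₂ _+_ (shiftT-·ᵥ 1<n (λ _ → 1ℤ) y) (Tinv-·ᵥ 1<n Tinv T⊗Tinv≡I (λ _ → 1ℤ) y))

  A-·ᵥ : ∀ w y → (A⟨ Tinv ⟩ ·ᵥ w) y ≡ + 4 * w y + (- (shiftT ·ᵥ w) y + - (Tinv ·ᵥ w) y)
  A-·ᵥ w y = begin
    (A⟨ Tinv ⟩ ·ᵥ w) y
      ≡⟨ ⊕-·ᵥ ((+ 4) ⊛ Id) ((⊝ shiftT) ⊕ (⊝ Tinv)) w y ⟩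
    (((+ 4) ⊛ Id) ·ᵥ w) y + (((⊝ shiftT) ⊕ (⊝ Tinv)) ·ᵥ w) y
      ≡⟨ cong₂ _+_ (trans (⊛-·ᵥ (+ 4) Id w y) (cong (+ 4 *_) (Id-·ᵥ w y)))
                   (trans (⊕-·ᵥ (⊝ shiftT) (⊝ Tinv) w y) (cong₂ _+_ (⊝-·ᵥ shiftT w y) (⊝-·ᵥ Tinv w y))) ⟩
    + 4 * w y + (- (shiftT ·ᵥ w) y + - (Tinv ·ᵥ w) y) ∎

  laplacian-combine-·ᵥ : ∀ z x y →
    (laplacian (ΔAdj n) ·ᵥ z) (combine x y) ≡ ((Id ⊕ A⟨ Tinv ⟩) ·ᵥ block z x) y - blockSum z y
  laplacian-combine-·ᵥ z x y = begin
    (laplacian (ΔAdj n) ·ᵥ z) (combine x y)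
      ≡⟨ laplacian-·ᵥ (ΔAdj n) z (combine x y) ⟩
    degree (ΔAdj n) (combine x y) * zₓ y - (adjacency (ΔAdj n) ·ᵥ z) (combine x y)
      ≡⟨ cong₂ (λ d a → d * zₓ y - a) (degree-combine x y) (adjacency-·ᵥ z x y) ⟩
    + 4 * zₓ y - (((shiftT ⊕ Tinv) ·ᵥ zₓ) y - zₓ y + blockSum z y)
      ≡⟨ cong (λ t → + 4 * zₓ y - (t - zₓ y + blockSum z y)) (⊕-·ᵥ shiftT Tinv zₓ y) ⟩
    + 4 * zₓ y - ((shiftT ·ᵥ zₓ) y + (Tinv ·ᵥ zₓ) y - zₓ y + blockSum z y)
      ≡⟨ ring (zₓ y) ((shiftT ·ᵥ zₓ) y) ((Tinv ·ᵥ zₓ) y) (blockSum z y) ⟩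
    (zₓ y + (+ 4 * zₓ y + (- (shiftT ·ᵥ zₓ) y + - (Tinv ·ᵥ zₓ) y))) - blockSum z y
      ≡⟨ cong (λ t → zₓ y + t - blockSum z y) (A-·ᵥ zₓ y) ⟨
    (zₓ y + (A⟨ Tinv ⟩ ·ᵥ zₓ) y) - blockSum z y
      ≡⟨ cong (_- blockSum z y) (Id⊕-·ᵥ A⟨ Tinv ⟩ zₓ y) ⟨
    ((Id ⊕ A⟨ Tinv ⟩) ·ᵥ zₓ) y - blockSum z y ∎
    where
    zₓ = block z x
    ring : ∀ v t t⁻¹ s → + 4 * v - (t + t⁻¹ - v + s) ≡ (v + (+ 4 * v + (- t + - t⁻¹))) - s
    ring = solve-∀

proposition1 : (n : ℕ) .{{_ : NonZero n}} → 3 ≤ n →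
  (Tinv : Matrix n) → (shiftT ⊗ Tinv) ≡ₘ Id → (Tinv ⊗ shiftT) ≡ₘ Id →
  let A = ((+ 4) ⊛ Id) ⊕ ((⊝ shiftT) ⊕ (⊝ Tinv)) in
  Jac (ΔAdj n) ≅
    torsionSubgroup
      (abelianGroup (coker (Id ⊕ A)) (coker ((((- (+ 2)) ⊛ Id) ⊕ A) ⊗ (Id ⊕ A))))
-- T ⊗ Tinv ≡ Id alone already pins Tinv down.
proposition1 n 2<n Tinv T⊗Tinv≡I _ =
  let A = ((+ 4) ⊛ Id) ⊕ ((⊝ shiftT) ⊕ (⊝ Tinv)) in
  torsionSubgroup-≅ {G = coker (laplacian (ΔAdj n))}
    {abelianGroup (coker (Id ⊕ A)) (coker ((((- (+ 2)) ⊛ Id) ⊕ A) ⊗ (Id ⊕ A)))}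
    (BlockCokernel.coker-≅ (Id ⊕ A) ((((- (+ 2)) ⊛ Id) ⊕ A) ⊗ (Id ⊕ A)) (laplacian (ΔAdj n))
      ([-2I+A]⊗[I+A]-·ᵥ A) (Δ.laplacian-combine-·ᵥ n 2<n Tinv T⊗Tinv≡I))
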